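{- Fix a type $\tau$. Let $\mathbf{Lat}$ be the category of complete lattices whose morphisms are maps preserving $0$, $1$, binary meets and arbitrary joins; let $\mathbf{Rel}_\tau$ be the category of relational structures of type $\tau$ with $p$-morphisms; let $\mathbf{Alg}_\tau$ be the category of complete lattices equipped with operations $(f_i)_{i\in I}$ of type $\tau$, whose morphisms are maps preserving $0,1$, binary meets, binary joins and each $f_i$. Then: (a) The assignment $(L,\mathfrak{X})\mapsto L^{\mathfrak{X}}$, sending a morphism $\phi:L\to M$ of $\mathbf{Lat}$ to $\phi^{\mathfrak{X}}:L^{\mathfrak{X}}\to M^{\mathfrak{X}}$, $\phi^{\mathfrak{X}}(\alpha)=\phi\circ\alpha$, and a $p$-morphism $p:\mathfrak{X}\to\mathfrak{Y}$ to $p^L:L^{\mathfrak{Y}}\to L^{\mathfrak{X}}$, $p^L(\beta)=\beta\circ p$, is a bifunctor $\mathbf{Lat}\times\mathbf{Rel}_\tau\to\mathbf{Alg}_\tau$, covariant in the first argument and contravariant in the second (in particular all $\phi^{\mathfrak{X}}$ and $p^L$ are morphisms of $\mathbf{Alg}_\tau$). (b) For any family $(L_j)_{j\in J}$ of complete lattices, $(\prod_J L_j)^{\mathfrak{X}}\cong\prod_J L_j^{\mathfrak{X}}$ as algebras (bounded lattice operations and the $f_i$). (c) For any family $(\mathfrak{X}_j)_{j\in J}$ of relational structures of type $\tau$ with disjoint union (coproduct) $\bigoplus_J\mathfrak{X}_j$, $L^{\bigoplus_J\mathfrak{X}_j}\cong\prod_J L^{\mathfrak{X}_j}$. (d) If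 $\phi$ is one-one (resp. onto) then $\phi^{\mathfrak{X}}$ is one-one (resp. onto); if $X$ has at least one element, the converses hold as well. (e) If a $p$-morphism $p$ is one-one then $p^L$ is onto, and if $p$ is onto then $p^L$ is one-one.
   Context: A type is $\tau:I\to\mathbb{N}$, $n_i=\tau(i)$. A relational structure of type $\tau$ is $\mathfrak{X}=(X,(R_i)_{i\in I})$ with $R_i\subseteq X^{n_i+1}$. For a complete lattice $L$, $L^{\mathfrak{X}}$ is the set of functions $X\to L$ with pointwise $\wedge,\vee,0,1$ and operations $f_i(\alpha_1,\ldots,\alpha_{n_i})(x)=\bigvee\{\alpha_1(x_1)\wedge\cdots\wedge\alpha_{n_i}(x_{n_i}):(x_1,\ldots,x_{n_i},x)\in R_i\}$. For relational structures $\mathfrak{X}=(X,(R_i))$, $\mathfrak{Y}=(Y,(S_i))$ of type $\tau$, a $p$-morphism is a function $p:X\to Y$ such that for each $i\in I$ and $x\in X$: $\{(y_1,\ldots,y_{n_i}):(y_1,\ldots,y_{n_i},p(x))\in S_i\}=\{(p(x_1),\ldots,p(x_{n_i})):(x_1,\ldots,x_{n_i},x)\in R_i\}$. The disjoint union $\bigoplus_J\mathfrak{X}_j$ has universe the disjoint union of the $X_j$ and $i$-th relation the union of the $i$-th relations of the $\mathfrak{X}_j$. -}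

module Defs where

open import Level using (Level; _⊔_) renaming (suc to lsuc)
open import Data.Nat using (ℕ; zero; suc)
open import Data.Vec using (Vec; []; _∷_; map; zipWith)
open import Data.Product using (Σ; _,_; _×_)
open import Relation.Binary.PropositionalEquality using (_≡_)
open import Relation.Binary.Structures using (IsPartialOrder)

record Type (t : Level) : Set (lsuc t) where
  field
    I     : Set t
    arity : I → ℕ
open Type public

record RawCL (c ℓ ι : Level) : Set (lsuc (c ⊔ ℓ ⊔ ι)) where
  infix 4 _≈_ _≤_
  infixr 6 _∨_
  infixr 7 _∧_
  field
    Carrier : Set c
    _≈_     : Carrier → Carrier → Set ℓ
    _≤_     : Carrier → Carrier → Set ℓ
    ⊥ ⊤     : Carrier
    _∧_ _∨_ : Carrier → Carrier → Carrier
    ⋁       : (A : Set ι) → (A → Carrier) → Carrier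

record IsCompleteLattice {c ℓ ι} (L : RawCL c ℓ ι) : Set (c ⊔ ℓ ⊔ lsuc ι) where
  open RawCL L
  field
    isPartialOrder : IsPartialOrder _≈_ _≤_
    ⊥-least    : ∀ x → ⊥ ≤ x
    ⊤-greatest : ∀ x → x ≤ ⊤
    ∧-lb₁      : ∀ x y → x ∧ y ≤ x
    ∧-lb₂      : ∀ x y → x ∧ y ≤ y
    ∧-glb      : ∀ x y z → z ≤ x → z ≤ y → z ≤ x ∧ y
    ∨-ub₁      : ∀ x y → x ≤ x ∨ y
    ∨-ub₂      : ∀ x y → y ≤ x ∨ y
    ∨-lub      : ∀ x y z → x ≤ z → y ≤ z → x ∨ y ≤ z
    ⋁-ub       : ∀ (A : Set ι) (f : A → Carrier) (a : A) → f a ≤ ⋁ A f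
    ⋁-lub      : ∀ (A : Set ι) (f : A → Carrier) (z : Carrier) →
                 (∀ a → f a ≤ z) → ⋁ A f ≤ z

record CompleteLattice (c ℓ ι : Level) : Set (lsuc (c ⊔ ℓ ⊔ ι)) where
  field
    raw               : RawCL c ℓ ι
    isCompleteLattice : IsCompleteLattice raw
  open RawCL raw public

open CompleteLattice public using (raw)

record RawAlg {t} (τ : Type t) (c ℓ ι : Level) : Set (lsuc (c ⊔ ℓ ⊔ ι) ⊔ t) where
  field
    lat : RawCL c ℓ ι
  open RawCL lat public
  field
    op  : (i : I τ) → Vec Carrier (arity τ i) → Carrier

-- Relational structures of type τ: R i (x₁,…,xₙ) x  means (x₁,…,xₙ,x) ∈ R_i

record RelStr {t} (τ : Type t) (ι : Level) : Set (lsuc ι ⊔ t) where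
  field
    X : Set ι
    R : (i : I τ) → Vec X (arity τ i) → X → Set ι
open RelStr public

IsPMorphism : ∀ {t ι} {τ : Type t} (𝔛 : RelStr τ ι) (𝔜 : RelStr τ ι) →
              (X 𝔛 → X 𝔜) → Set (t ⊔ ι)
IsPMorphism {τ = τ} 𝔛 𝔜 p =
  ∀ (i : I τ) (x : X 𝔛) (ys : Vec (X 𝔜) (arity τ i)) →
    (R 𝔜 i ys (p x) → Σ (Vec (X 𝔛) (arity τ i)) λ xs → R 𝔛 i xs x × map p xs ≡ ys)
  × (Σ (Vec (X 𝔛) (arity τ i)) (λ xs → R 𝔛 i xs x × map p xs ≡ ys) → R 𝔜 i ys (p x))

⨁ : ∀ {t ι} {τ : Type t} (J : Set ι) → (J → RelStr τ ι) → RelStr τ ι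
⨁ {τ = τ} J 𝔛 = record
  { X = Σ J (λ j → X (𝔛 j))
  ; R = λ i xs x → Σ J λ j → Σ (Vec (X (𝔛 j)) (arity τ i)) λ ys → Σ (X (𝔛 j)) λ y →
          (xs ≡ map (λ z → (j , z)) ys) × (x ≡ (j , y)) × R (𝔛 j) i ys y
  }

⋀ : ∀ {c ℓ ι} (L : RawCL c ℓ ι) {n : ℕ} → Vec (RawCL.Carrier L) n → RawCL.Carrier L
⋀ L []       = RawCL.⊤ L
⋀ L (a ∷ as) = RawCL._∧_ L a (⋀ L as)

_^_ : ∀ {t c ℓ ι} {τ : Type t} → RawCL c ℓ ι → RelStr τ ι → RawAlg τ (ι ⊔ c) (ι ⊔ ℓ) ι
_^_ {τ = τ} L 𝔛 = record
  { lat = record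
    { Carrier = X 𝔛 → Carrier
    ; _≈_ = λ α β → ∀ x → α x ≈ β x
    ; _≤_ = λ α β → ∀ x → α x ≤ β x
    ; ⊥ = λ _ → ⊥
    ; ⊤ = λ _ → ⊤
    ; _∧_ = λ α β x → α x ∧ β x
    ; _∨_ = λ α β x → α x ∨ β x
    ; ⋁ = λ A F x → ⋁ A (λ a → F a x)
    }
  ; op = λ i αs x →
      ⋁ (Σ (Vec (X 𝔛) (arity τ i)) (λ xs → R 𝔛 i xs x))
        (λ { (xs , _) → ⋀ L (zipWith (λ α y → α y) αs xs) })
  }
  where open RawCL L

liftL : ∀ {t c ℓ c' ℓ' ι} {τ : Type t} (L : RawCL c ℓ ι) (M : RawCL c' ℓ' ι) →
        (RawCL.Carrier L → RawCL.Carrier M) → (𝔛 : RelStr τ ι) →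
        (X 𝔛 → RawCL.Carrier L) → (X 𝔛 → RawCL.Carrier M)
liftL L M φ 𝔛 α = λ x → φ (α x)

liftR : ∀ {t c ℓ ι} {τ : Type t} (L : RawCL c ℓ ι) (𝔛 𝔜 : RelStr τ ι) →
        (X 𝔛 → X 𝔜) → (X 𝔜 → RawCL.Carrier L) → (X 𝔛 → RawCL.Carrier L)
liftR L 𝔛 𝔜 p β = λ x → β (p x)

∏CL : ∀ {c ℓ ι} (J : Set ι) → (J → RawCL c ℓ ι) → RawCL (ι ⊔ c) (ι ⊔ ℓ) ι
∏CL J L = record
  { Carrier = (j : J) → RawCL.Carrier (L j)
  ; _≈_ = λ a b → ∀ j → RawCL._≈_ (L j) (a j) (b j)
  ; _≤_ = λ a b → ∀ j → RawCL._≤_ (L j) (a j) (b j)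
  ; ⊥ = λ j → RawCL.⊥ (L j)
  ; ⊤ = λ j → RawCL.⊤ (L j)
  ; _∧_ = λ a b j → RawCL._∧_ (L j) (a j) (b j)
  ; _∨_ = λ a b j → RawCL._∨_ (L j) (a j) (b j)
  ; ⋁ = λ A F j → RawCL.⋁ (L j) A (λ a → F a j)
  }

∏Alg : ∀ {t c ℓ ι} {τ : Type t} (J : Set ι) → (J → RawAlg τ c ℓ ι) → RawAlg τ (ι ⊔ c) (ι ⊔ ℓ) ι
∏Alg {τ = τ} J A = record
  { lat = ∏CL J (λ j → RawAlg.lat (A j))
  ; op  = λ i as j → RawAlg.op (A j) i (map (λ a → a j) as)
  }

record IsLatHom {c ℓ c' ℓ' ι} (L : RawCL c ℓ ι) (M : RawCL c' ℓ' ι)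
                (φ : RawCL.Carrier L → RawCL.Carrier M) : Set (c ⊔ ℓ ⊔ ℓ' ⊔ lsuc ι) where
  private
    module L = RawCL L
    module M = RawCL M
  field
    cong  : ∀ {a b} → a L.≈ b → φ a M.≈ φ b
    pres-⊥ : φ L.⊥ M.≈ M.⊥
    pres-⊤ : φ L.⊤ M.≈ M.⊤
    pres-∧ : ∀ a b → φ (a L.∧ b) M.≈ (φ a M.∧ φ b)
    pres-⋁ : ∀ (A : Set ι) (f : A → L.Carrier) → φ (L.⋁ A f) M.≈ M.⋁ A (λ a → φ (f a))

record IsAlgHom {t c ℓ c' ℓ' ι} {τ : Type t} (A : RawAlg τ c ℓ ι) (B : RawAlg τ c' ℓ' ι)
                (h : RawAlg.Carrier A → RawAlg.Carrier B) : Set (t ⊔ c ⊔ ℓ ⊔ ℓ') where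
  private
    module A = RawAlg A
    module B = RawAlg B
  field
    cong   : ∀ {a b} → a A.≈ b → h a B.≈ h b
    pres-⊥ : h A.⊥ B.≈ B.⊥
    pres-⊤ : h A.⊤ B.≈ B.⊤
    pres-∧ : ∀ a b → h (a A.∧ b) B.≈ (h a B.∧ h b)
    pres-∨ : ∀ a b → h (a A.∨ b) B.≈ (h a B.∨ h b)
    pres-op : ∀ (i : I τ) (as : Vec A.Carrier (arity τ i)) →
              h (A.op i as) B.≈ B.op i (map h as)

record _≅_ {t c ℓ c' ℓ' ι} {τ : Type t} (A : RawAlg τ c ℓ ι) (B : RawAlg τ c' ℓ' ι)
           : Set (t ⊔ c ⊔ ℓ ⊔ c' ⊔ ℓ') where
  field
    to       : RawAlg.Carrier A → RawAlg.Carrier B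
    from     : RawAlg.Carrier B → RawAlg.Carrier A
    to-hom   : IsAlgHom A B to
    from-hom : IsAlgHom B A from
    from∘to  : ∀ a → RawAlg._≈_ A (from (to a)) a
    to∘from  : ∀ b → RawAlg._≈_ B (to (from b)) b

OneOne : ∀ {a b ℓ₁ ℓ₂} {A : Set a} {B : Set b} →
         (A → A → Set ℓ₁) → (B → B → Set ℓ₂) → (A → B) → Set (a ⊔ ℓ₁ ⊔ ℓ₂)
OneOne _≈₁_ _≈₂_ f = ∀ x y → f x ≈₂ f y → x ≈₁ y

Onto : ∀ {a b ℓ₂} {A : Set a} {B : Set b} → (B → B → Set ℓ₂) → (A → B) → Set (a ⊔ b ⊔ ℓ₂)
Onto {A = A} _≈₂_ f = ∀ y → Σ A λ x → f x ≈₂ y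

module Submission where

-- As a lattice, L^𝔛 is the power L^X, so everything lattice-theoretic
-- is pointwise; the only real content concerns the operations
--   f_i(α⃗)(x) = ⋁ { ⋀ α⃗(x⃗) : R_i(x⃗, x) }.
-- Two "naturality" lemmas carry the whole proof:
--   * op-postcompose: a Lat-morphism φ commutes with f_i, because it
--     preserves ⋁ and finite ⋀;
--   * op-pullback: precomposition with a p-morphism p commutes with f_i,
--     because the p-morphism condition makes the two families of joinands
--     mutually cofinal.  For (b) the projections ∏ L_j → L_j are
-- Lat-morphisms, and for (c) the coproduct injections 𝔛_j → ⨁ 𝔛 are
-- p-morphisms; in both cases the isomorphism is the tuple of the induced
-- algebra morphisms, and its inverse is handled by the same two lemmas.

open import Defs
open import Level using (Level; Lift; lift; _⊔_)
open import Function using (id; _∘_; _$_)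
open import Data.Bool using (Bool; true; false)
open import Data.Vec using (Vec; []; _∷_; map; zipWith)
open import Data.Vec.Properties using (map-∘; zipWith-map₁; zipWith-map₂)
open import Data.Product using (Σ; _×_; _,_; proj₁; proj₂)
open import Relation.Binary.PropositionalEquality
  using (_≡_; refl; sym; trans; cong; subst)
open import Relation.Binary.Structures using (IsPartialOrder)
open import Relation.Binary.Bundles using (Setoid)
import Relation.Binary.Reasoning.Setoid as SetoidReasoning

eval-postcompose : ∀ {a b c} {A : Set a} {B : Set b} {C : Set c} {n}
                   (φ : B → C) (fs : Vec (A → B) n) (xs : Vec A n) →
                   zipWith _$_ (map (φ ∘_) fs) xs ≡ map φ (zipWith _$_ fs xs)
eval-postcompose φ []       []       = refl
eval-postcompose φ (f ∷ fs) (x ∷ xs) = cong (φ (f x) ∷_) (eval-postcompose φ fs xs)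

eval-precompose : ∀ {a b c} {A : Set a} {B : Set b} {C : Set c} {n}
                  (p : A → B) (fs : Vec (B → C) n) (xs : Vec A n) →
                  zipWith _$_ (map (_∘ p) fs) xs ≡ zipWith _$_ fs (map p xs)
eval-precompose p fs xs =
  trans (zipWith-map₁ _$_ (_∘ p) fs xs) (sym (zipWith-map₂ _$_ p fs xs))

module CL {c ℓ ι} (L : CompleteLattice c ℓ ι) where
  open CompleteLattice L public
  open IsCompleteLattice (CompleteLattice.isCompleteLattice L) public
  open IsPartialOrder isPartialOrder public
    using (antisym; reflexive; isEquivalence; module Eq) renaming (trans to ≤-trans)

  setoid : Setoid c ℓ
  setoid = record { isEquivalence = isEquivalence }

  ≡⇒≤ : ∀ {a b} → a ≡ b → a ≤ b
  ≡⇒≤ a≡b = reflexive (Eq.reflexive a≡b)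

  ⋁-cofinal : ∀ {A B : Set ι} {f : A → Carrier} {g : B → Carrier} →
              (∀ a → Σ B λ b → f a ≤ g b) → ⋁ A f ≤ ⋁ B g
  ⋁-cofinal {B = B} {g = g} below = ⋁-lub _ _ _ λ a →
    ≤-trans (proj₂ (below a)) (⋁-ub B g (proj₁ (below a)))

  ⋁-mutually-cofinal : ∀ {A B : Set ι} {f : A → Carrier} {g : B → Carrier} →
                       (∀ a → Σ B λ b → f a ≤ g b) →
                       (∀ b → Σ A λ a → g b ≤ f a) → ⋁ A f ≈ ⋁ B g
  ⋁-mutually-cofinal f≤g g≤f = antisym (⋁-cofinal f≤g) (⋁-cofinal g≤f)

  ⋁-cong : ∀ {A : Set ι} {f g : A → Carrier} → (∀ a → f a ≈ g a) → ⋁ A f ≈ ⋁ A g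
  ⋁-cong f≈g = ⋁-mutually-cofinal (λ a → a , reflexive (f≈g a))
                                  (λ a → a , reflexive (Eq.sym (f≈g a)))

  ∧-cong : ∀ {a b a' b'} → a ≈ a' → b ≈ b' → a ∧ b ≈ a' ∧ b'
  ∧-cong {a} {b} {a'} {b'} a≈a' b≈b' = antisym
    (∧-glb a' b' _ (≤-trans (∧-lb₁ a b) (reflexive a≈a'))
                   (≤-trans (∧-lb₂ a b) (reflexive b≈b')))
    (∧-glb a b _ (≤-trans (∧-lb₁ a' b') (reflexive (Eq.sym a≈a')))
                 (≤-trans (∧-lb₂ a' b') (reflexive (Eq.sym b≈b'))))

  -- A binary join is the join of a two-element family; this is how
  -- ⋁-preserving maps are seen to preserve ∨.
  pair : Carrier → Carrier → Lift ι Bool → Carrier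
  pair a b (lift true)  = a
  pair a b (lift false) = b

  ∨≈⋁-pair : ∀ a b → a ∨ b ≈ ⋁ (Lift ι Bool) (pair a b)
  ∨≈⋁-pair a b = antisym
    (∨-lub a b _ (⋁-ub _ (pair a b) (lift true)) (⋁-ub _ (pair a b) (lift false)))
    (⋁-lub _ (pair a b) _ λ { (lift true) → ∨-ub₁ a b ; (lift false) → ∨-ub₂ a b })

∏-isCompleteLattice : ∀ {c ℓ ι} (J : Set ι) (L : J → CompleteLattice c ℓ ι) →
                      IsCompleteLattice (∏CL J (λ j → raw (L j)))
∏-isCompleteLattice J L = record
  { isPartialOrder = record
    { isPreorder = record
      { isEquivalence = record
        { refl  = λ j → Eq.refl j
        ; sym   = λ a≈b j → Eq.sym j (a≈b j)
        ; trans = λ a≈b b≈c j → Eq.trans j (a≈b j) (b≈c j) }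
      ; reflexive = λ a≈b j → reflexive j (a≈b j)
      ; trans     = λ a≤b b≤c j → ≤-trans j (a≤b j) (b≤c j) }
    ; antisym = λ a≤b b≤a j → antisym j (a≤b j) (b≤a j) }
  ; ⊥-least    = λ a j → ⊥-least j (a j)
  ; ⊤-greatest = λ a j → ⊤-greatest j (a j)
  ; ∧-lb₁      = λ a b j → ∧-lb₁ j (a j) (b j)
  ; ∧-lb₂      = λ a b j → ∧-lb₂ j (a j) (b j)
  ; ∧-glb      = λ a b d d≤a d≤b j → ∧-glb j (a j) (b j) (d j) (d≤a j) (d≤b j)
  ; ∨-ub₁      = λ a b j → ∨-ub₁ j (a j) (b j)
  ; ∨-ub₂      = λ a b j → ∨-ub₂ j (a j) (b j)
  ; ∨-lub      = λ a b d a≤d b≤d j → ∨-lub j (a j) (b j) (d j) (a≤d j) (b≤d j)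
  ; ⋁-ub       = λ A F a j → ⋁-ub j A (λ b → F b j) a
  ; ⋁-lub      = λ A F d F≤d j → ⋁-lub j A (λ b → F b j) (d j) (λ a → F≤d a j)
  }
  where open module Lj (j : J) = CL (L j)

∏-CL : ∀ {c ℓ ι} (J : Set ι) → (J → CompleteLattice c ℓ ι) →
       CompleteLattice (ι ⊔ c) (ι ⊔ ℓ) ι
∏-CL J L = record
  { raw               = ∏CL J (λ j → raw (L j))
  ; isCompleteLattice = ∏-isCompleteLattice J L
  }

power-isCompleteLattice : ∀ {t c ℓ ι} {τ : Type t}
                          (L : CompleteLattice c ℓ ι) (𝔛 : RelStr τ ι) →
                          IsCompleteLattice (RawAlg.lat (raw L ^ 𝔛))
power-isCompleteLattice L 𝔛 = ∏-isCompleteLattice (X 𝔛) (λ _ → L)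

-- Naturality in L: a Lat-morphism φ commutes with every f_i, since
-- f_i(α⃗)(x) is a join of finite meets of values of the αₖ.  Only the target
-- needs to be a complete lattice.
module _ {c ℓ c' ℓ' ι} {L : RawCL c ℓ ι} (M : CompleteLattice c' ℓ' ι)
         {φ : RawCL.Carrier L → CompleteLattice.Carrier M} (hφ : IsLatHom L (raw M) φ) where
  private
    module M = CL M
    module H = IsLatHom hφ

  pres-⋀ : ∀ {n} (as : Vec (RawCL.Carrier L) n) →
           φ (⋀ L as) M.≈ ⋀ (raw M) (map φ as)
  pres-⋀ []       = H.pres-⊤
  pres-⋀ (a ∷ as) = M.Eq.trans (H.pres-∧ a (⋀ L as)) (M.∧-cong M.Eq.refl (pres-⋀ as))

  op-postcompose : ∀ {t} {τ : Type t} (𝔛 : RelStr τ ι) (i : I τ)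
                   (αs : Vec (X 𝔛 → RawCL.Carrier L) (arity τ i)) (x : X 𝔛) →
                   φ (RawAlg.op (L ^ 𝔛) i αs x)
                     M.≈ RawAlg.op (raw M ^ 𝔛) i (map (liftL L (raw M) φ 𝔛) αs) x
  op-postcompose 𝔛 i αs x = M.Eq.trans (H.pres-⋁ _ _) (M.⋁-cong λ xr →
    M.Eq.trans (pres-⋀ (zipWith _$_ αs (proj₁ xr)))
               (M.Eq.reflexive (cong (⋀ (raw M)) (sym (eval-postcompose φ αs (proj₁ xr))))))

pres-∨ : ∀ {c ℓ c' ℓ' ι} (L : CompleteLattice c ℓ ι) (M : CompleteLattice c' ℓ' ι)
         {φ : CompleteLattice.Carrier L → CompleteLattice.Carrier M} →
         IsLatHom (raw L) (raw M) φ → ∀ a b →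
         CompleteLattice._≈_ M (φ (CompleteLattice._∨_ L a b))
                               (CompleteLattice._∨_ M (φ a) (φ b))
pres-∨ L M {φ} hφ a b = begin
  φ (a L.∨ b)                     ≈⟨ H.cong (L.∨≈⋁-pair a b) ⟩
  φ (L.⋁ _ (L.pair a b))          ≈⟨ H.pres-⋁ _ (L.pair a b) ⟩
  M.⋁ _ (φ ∘ L.pair a b)          ≈⟨ M.⋁-cong φ∘pair ⟩
  M.⋁ _ (M.pair (φ a) (φ b))      ≈⟨ M.Eq.sym (M.∨≈⋁-pair (φ a) (φ b)) ⟩
  φ a M.∨ φ b                     ∎
  where
  module L = CL L
  module M = CL M
  module H = IsLatHom hφ
  open SetoidReasoning M.setoid

  φ∘pair : ∀ k → φ (L.pair a b k) M.≈ M.pair (φ a) (φ b) k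
  φ∘pair (lift true)  = M.Eq.refl
  φ∘pair (lift false) = M.Eq.refl

liftL-isAlgHom : ∀ {t c ℓ c' ℓ' ι} {τ : Type t}
                 (L : CompleteLattice c ℓ ι) (M : CompleteLattice c' ℓ' ι)
                 (φ : CompleteLattice.Carrier L → CompleteLattice.Carrier M) →
                 IsLatHom (raw L) (raw M) φ → (𝔛 : RelStr τ ι) →
                 IsAlgHom (raw L ^ 𝔛) (raw M ^ 𝔛) (liftL (raw L) (raw M) φ 𝔛)
liftL-isAlgHom L M φ hφ 𝔛 = record
  { cong    = λ α≈β x → H.cong (α≈β x)
  ; pres-⊥  = λ _ → H.pres-⊥
  ; pres-⊤  = λ _ → H.pres-⊤
  ; pres-∧  = λ α β x → H.pres-∧ (α x) (β x)
  ; pres-∨  = λ α β x → pres-∨ L M hφ (α x) (β x)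
  ; pres-op = op-postcompose M hφ 𝔛
  }
  where module H = IsLatHom hφ

-- The joinands of f_i(β⃗)(p x), indexed by R_i(y⃗, p x), and those of
-- f_i(β⃗ ∘ p)(x), indexed by R_i(x⃗, x), are mutually cofinal: the
-- p-morphism condition matches each y⃗ with some x⃗ satisfying p(x⃗) = y⃗.
op-pullback : ∀ {t c ℓ ι} {τ : Type t} (L : CompleteLattice c ℓ ι) (𝔛 𝔜 : RelStr τ ι)
              (p : X 𝔛 → X 𝔜) → IsPMorphism 𝔛 𝔜 p → ∀ (i : I τ)
              (βs : Vec (X 𝔜 → CompleteLattice.Carrier L) (arity τ i)) (x : X 𝔛) →
              CompleteLattice._≈_ L (RawAlg.op (raw L ^ 𝔜) i βs (p x))
                                    (RawAlg.op (raw L ^ 𝔛) i (map (liftR (raw L) 𝔛 𝔜 p) βs) x)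
op-pullback {τ = τ} L 𝔛 𝔜 p pm i βs x =
  L.⋁-mutually-cofinal (λ { (ys , s) → preimage ys (proj₁ (pm i x ys) s) })
                       (λ { (xs , r) → image xs r })
  where
  module L = CL L

  meet𝔜 : Vec (X 𝔜) (arity τ i) → L.Carrier
  meet𝔜 ys = ⋀ (raw L) (zipWith _$_ βs ys)

  meet𝔛 : Vec (X 𝔛) (arity τ i) → L.Carrier
  meet𝔛 xs = ⋀ (raw L) (zipWith _$_ (map (liftR (raw L) 𝔛 𝔜 p) βs) xs)

  meet-at-image : ∀ xs → meet𝔜 (map p xs) ≡ meet𝔛 xs
  meet-at-image xs = cong (⋀ (raw L)) (sym (eval-precompose p βs xs))

  preimage : ∀ ys → Σ (Vec (X 𝔛) (arity τ i)) (λ xs → R 𝔛 i xs x × map p xs ≡ ys) →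
             Σ (Σ (Vec (X 𝔛) (arity τ i)) λ xs → R 𝔛 i xs x) λ xr → meet𝔜 ys L.≤ meet𝔛 (proj₁ xr)
  preimage _ (xs , r , refl) = (xs , r) , L.≡⇒≤ (meet-at-image xs)

  image : ∀ xs → R 𝔛 i xs x →
          Σ (Σ (Vec (X 𝔜) (arity τ i)) λ ys → R 𝔜 i ys (p x)) λ ys → meet𝔛 xs L.≤ meet𝔜 (proj₁ ys)
  image xs r = (map p xs , proj₂ (pm i x (map p xs)) (xs , r , refl))
             , L.≡⇒≤ (sym (meet-at-image xs))

liftR-isAlgHom : ∀ {t c ℓ ι} {τ : Type t} (L : CompleteLattice c ℓ ι) (𝔛 𝔜 : RelStr τ ι)
                 (p : X 𝔛 → X 𝔜) → IsPMorphism 𝔛 𝔜 p →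
                 IsAlgHom (raw L ^ 𝔜) (raw L ^ 𝔛) (liftR (raw L) 𝔛 𝔜 p)
liftR-isAlgHom L 𝔛 𝔜 p pm = record
  { cong    = λ α≈β x → α≈β (p x)
  ; pres-⊥  = λ _ → L.Eq.refl
  ; pres-⊤  = λ _ → L.Eq.refl
  ; pres-∧  = λ _ _ _ → L.Eq.refl
  ; pres-∨  = λ _ _ _ → L.Eq.refl
  ; pres-op = op-pullback L 𝔛 𝔜 p pm
  }
  where module L = CL L

tuple-isAlgHom : ∀ {t c ℓ c' ℓ' ι} {τ : Type t} {A : RawAlg τ c ℓ ι} {J : Set ι}
                 {B : J → RawAlg τ c' ℓ' ι}
                 (h : ∀ j → RawAlg.Carrier A → RawAlg.Carrier (B j)) →
                 (∀ j → IsAlgHom A (B j) (h j)) → IsAlgHom A (∏Alg J B) (λ a j → h j a)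
tuple-isAlgHom {A = A} {B = B} h hom = record
  { cong    = λ a≈b j → H.cong j a≈b
  ; pres-⊥  = λ j → H.pres-⊥ j
  ; pres-⊤  = λ j → H.pres-⊤ j
  ; pres-∧  = λ a b j → H.pres-∧ j a b
  ; pres-∨  = λ a b j → H.pres-∨ j a b
  ; pres-op = λ i as j →
      subst (λ bs → RawAlg._≈_ (B j) (h j (RawAlg.op A i as)) (RawAlg.op (B j) i bs))
            (map-∘ (λ b → b j) (λ a k → h k a) as) (H.pres-op j i as)
  }
  where module H (j : _) = IsAlgHom (hom j)

-- The projections of ∏ L_j are Lat-morphisms, so
-- they lift to algebra morphisms (∏ L_j)^𝔛 → L_j^𝔛 whose tuple is the
-- isomorphism; its inverse is handled by the naturality lemma op-postcompose.
project : ∀ {c ℓ ι} (J : Set ι) (L : J → CompleteLattice c ℓ ι) (j : J) →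
          CompleteLattice.Carrier (∏-CL J L) → CompleteLattice.Carrier (L j)
project J L j a = a j

project-isLatHom : ∀ {c ℓ ι} (J : Set ι) (L : J → CompleteLattice c ℓ ι) (j : J) →
                   IsLatHom (raw (∏-CL J L)) (raw (L j)) (project J L j)
project-isLatHom J L j = record
  { cong   = λ a≈b → a≈b j
  ; pres-⊥ = Eq.refl
  ; pres-⊤ = Eq.refl
  ; pres-∧ = λ _ _ → Eq.refl
  ; pres-⋁ = λ _ _ → Eq.refl
  }
  where open CL (L j)

power-of-product : ∀ {t c ℓ ι} {τ : Type t} (J : Set ι) (L : J → CompleteLattice c ℓ ι)
                   (𝔛 : RelStr τ ι) →
                   (∏CL J (λ j → raw (L j)) ^ 𝔛) ≅ ∏Alg J (λ j → raw (L j) ^ 𝔛)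
power-of-product J L 𝔛 = record
  { to       = to
  ; from     = from
  ; to-hom   = tuple-isAlgHom π^𝔛 (λ j →
                 liftL-isAlgHom (∏-CL J L) (L j) (project J L j) (project-isLatHom J L j) 𝔛)
  ; from-hom = record
    { cong    = λ β≈γ x j → β≈γ j x
    ; pres-⊥  = λ _ j → Lj.Eq.refl j
    ; pres-⊤  = λ _ j → Lj.Eq.refl j
    ; pres-∧  = λ _ _ _ j → Lj.Eq.refl j
    ; pres-∨  = λ _ _ _ j → Lj.Eq.refl j
    ; pres-op = from-pres-op
    }
  ; from∘to  = λ _ _ j → Lj.Eq.refl j
  ; to∘from  = λ _ j _ → Lj.Eq.refl j
  }
  where
  module Lj (j : J) = CL (L j)
  ∏L = ∏CL J (λ j → raw (L j))
  ∏L^𝔛 = ∏L ^ 𝔛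
  ∏[L^𝔛] = ∏Alg J (λ j → raw (L j) ^ 𝔛)

  π^𝔛 : (j : J) → RawAlg.Carrier ∏L^𝔛 → RawAlg.Carrier (raw (L j) ^ 𝔛)
  π^𝔛 j = liftL ∏L (raw (L j)) (project J L j) 𝔛

  to : RawAlg.Carrier ∏L^𝔛 → RawAlg.Carrier ∏[L^𝔛]
  to α j = π^𝔛 j α

  from : RawAlg.Carrier ∏[L^𝔛] → RawAlg.Carrier ∏L^𝔛
  from β x j = β j x

  -- π_j^𝔛 ∘ from is evaluation at j, so op-postcompose for π_j applies.
  from-pres-op : ∀ i βs x j →
                 Lj._≈_ j (RawAlg.op (raw (L j) ^ 𝔛) i (map (λ β → β j) βs) x)
                          (RawAlg.op ∏L^𝔛 i (map from βs) x j)
  from-pres-op i βs x j = Lj.Eq.trans j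
    (Lj.Eq.reflexive j (cong (λ αs → RawAlg.op (raw (L j) ^ 𝔛) i αs x) (map-∘ (π^𝔛 j) from βs)))
    (Lj.Eq.sym j (op-postcompose (L j) (project-isLatHom J L j) 𝔛 i (map from βs) x))

-- (c) Disjoint unions.  The coproduct injections 𝔛_j → ⨁ 𝔛 are p-morphisms:
-- an ⨁-relation ending in (j , x) lives entirely inside the summand 𝔛_j.
inject : ∀ {t ι} {τ : Type t} (J : Set ι) (𝔛 : J → RelStr τ ι) (j : J) →
         X (𝔛 j) → X (⨁ J 𝔛)
inject J 𝔛 j x = j , x

inject-isPMorphism : ∀ {t ι} {τ : Type t} (J : Set ι) (𝔛 : J → RelStr τ ι) (j : J) →
                     IsPMorphism (𝔛 j) (⨁ J 𝔛) (inject J 𝔛 j)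
inject-isPMorphism {τ = τ} J 𝔛 j i x ys = restrict , extend
  where
  Preimage : Set _
  Preimage = Σ (Vec (X (𝔛 j)) (arity τ i)) λ xs →
               R (𝔛 j) i xs x × map (inject J 𝔛 j) xs ≡ ys

  restrict : R (⨁ J 𝔛) i ys (j , x) → Preimage
  restrict (_ , xs , _ , ys≡ , refl , r) = xs , r , sym ys≡

  extend : Preimage → R (⨁ J 𝔛) i ys (j , x)
  extend (xs , r , refl) = j , xs , x , refl , refl , r

-- The isomorphism is the tuple of the algebra morphisms induced by the
-- injections; its inverse is handled by the naturality lemma op-pullback.
power-of-coproduct : ∀ {t c ℓ ι} {τ : Type t} (L : CompleteLattice c ℓ ι) (J : Set ι)
                     (𝔛 : J → RelStr τ ι) →
                     (raw L ^ ⨁ J 𝔛) ≅ ∏Alg J (λ j → raw L ^ 𝔛 j)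
power-of-coproduct L J 𝔛 = record
  { to       = to
  ; from     = from
  ; to-hom   = tuple-isAlgHom ι^L (λ j →
                 liftR-isAlgHom L (𝔛 j) (⨁ J 𝔛) (inject J 𝔛 j) (inject-isPMorphism J 𝔛 j))
  ; from-hom = record
    { cong    = λ { β≈γ (j , x) → β≈γ j x }
    ; pres-⊥  = λ _ → L.Eq.refl
    ; pres-⊤  = λ _ → L.Eq.refl
    ; pres-∧  = λ _ _ _ → L.Eq.refl
    ; pres-∨  = λ _ _ _ → L.Eq.refl
    ; pres-op = λ { i βs (j , x) → from-pres-op i βs j x }
    }
  ; from∘to  = λ _ _ → L.Eq.refl
  ; to∘from  = λ _ _ _ → L.Eq.refl
  }
  where
  module L = CL L
  L^⨁𝔛 = raw L ^ ⨁ J 𝔛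
  ∏[L^𝔛] = ∏Alg J (λ j → raw L ^ 𝔛 j)

  ι^L : (j : J) → RawAlg.Carrier L^⨁𝔛 → RawAlg.Carrier (raw L ^ 𝔛 j)
  ι^L j = liftR (raw L) (𝔛 j) (⨁ J 𝔛) (inject J 𝔛 j)

  to : RawAlg.Carrier L^⨁𝔛 → RawAlg.Carrier ∏[L^𝔛]
  to α j = ι^L j α

  from : RawAlg.Carrier ∏[L^𝔛] → RawAlg.Carrier L^⨁𝔛
  from β (j , x) = β j x

  -- ι_j^L ∘ from is evaluation at j, so op-pullback for ι_j applies.
  from-pres-op : ∀ i βs j x →
                 RawAlg.op (raw L ^ 𝔛 j) i (map (λ β → β j) βs) x
                   L.≈ RawAlg.op L^⨁𝔛 i (map from βs) (j , x)
  from-pres-op i βs j x = L.Eq.trans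
    (L.Eq.reflexive (cong (λ αs → RawAlg.op (raw L ^ 𝔛 j) i αs x) (map-∘ (ι^L j) from βs)))
    (L.Eq.sym (op-pullback L (𝔛 j) (⨁ J 𝔛) (inject J 𝔛 j) (inject-isPMorphism J 𝔛 j)
                           i (map from βs) x))

-- (d) Postcomposition with φ is one-one/onto when φ is, pointwise; and
-- conversely when X is inhabited, by testing on constant functions.
module _ {t c ℓ c' ℓ' ι} {τ : Type t} (L : RawCL c ℓ ι) (M : RawCL c' ℓ' ι)
         (φ : RawCL.Carrier L → RawCL.Carrier M) (𝔛 : RelStr τ ι) where
  private
    φ^𝔛 = liftL L M φ 𝔛
    _≈ᴸ_ = RawAlg._≈_ (L ^ 𝔛)
    _≈ᴹ_ = RawAlg._≈_ (M ^ 𝔛)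

  liftL-oneOne : OneOne (RawCL._≈_ L) (RawCL._≈_ M) φ → OneOne _≈ᴸ_ _≈ᴹ_ φ^𝔛
  liftL-oneOne φ-injective α β φα≈φβ x = φ-injective (α x) (β x) (φα≈φβ x)

  liftL-onto : Onto (RawCL._≈_ M) φ → Onto _≈ᴹ_ φ^𝔛
  liftL-onto φ-onto β = (λ x → proj₁ (φ-onto (β x))) , (λ x → proj₂ (φ-onto (β x)))

  oneOne-of-liftL : X 𝔛 → OneOne _≈ᴸ_ _≈ᴹ_ φ^𝔛 →
                    OneOne (RawCL._≈_ L) (RawCL._≈_ M) φ
  oneOne-of-liftL x₀ lift-injective a b φa≈φb =
    lift-injective (λ _ → a) (λ _ → b) (λ _ → φa≈φb) x₀

  onto-of-liftL : X 𝔛 → Onto _≈ᴹ_ φ^𝔛 → Onto (RawCL._≈_ M) φ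
  onto-of-liftL x₀ lift-onto b =
    proj₁ (lift-onto (λ _ → b)) x₀ , proj₂ (lift-onto (λ _ → b)) x₀

module _ {t c ℓ ι} {τ : Type t} (L : CompleteLattice c ℓ ι) (𝔛 𝔜 : RelStr τ ι)
         (p : X 𝔛 → X 𝔜) where
  private
    module L = CL L
    p^L = liftR (raw L) 𝔛 𝔜 p

  -- For injective p, α extends along p to y ↦ ⋁ { α x : p x = y }.
  liftR-onto : OneOne _≡_ _≡_ p → Onto (RawAlg._≈_ (raw L ^ 𝔛)) p^L
  liftR-onto p-injective α = extension , λ x → L.antisym
    (L.⋁-lub _ _ _ λ x'p → L.≡⇒≤ (cong α (p-injective (proj₁ x'p) x (proj₂ x'p))))
    (L.⋁-ub _ (α ∘ proj₁) (x , refl))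
    where
    extension : X 𝔜 → L.Carrier
    extension y = L.⋁ (Σ (X 𝔛) λ x → p x ≡ y) (α ∘ proj₁)

  -- For surjective p, every point of 𝔜 is some p x, where β ∘ p and γ ∘ p agree.
  liftR-oneOne : Onto _≡_ p → OneOne (RawAlg._≈_ (raw L ^ 𝔜)) (RawAlg._≈_ (raw L ^ 𝔛)) p^L
  liftR-oneOne p-onto β γ βp≈γp y with p-onto y
  ... | x , refl = βp≈γp x

-- Theorem 3.15.  Functoriality holds definitionally, since φ^𝔛 and p^L are
-- given by composition of functions; parts (d) and (e) do not need the
-- morphism hypotheses on φ and p.
theorem3p15 : ∀ {t c ℓ c' ℓ' c'' ℓ'' ι : Level} (τ : Type t) →
  -- (a) L^𝔛 is an object of Alg_τ (a complete lattice) ...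
  ( (∀ (L : CompleteLattice c ℓ ι) (𝔛 : RelStr τ ι) →
       IsCompleteLattice (RawAlg.lat (raw L ^ 𝔛)))
  -- ... φ^𝔛 is a morphism of Alg_τ for every morphism φ of Lat ...
  × (∀ (L : CompleteLattice c ℓ ι) (M : CompleteLattice c' ℓ' ι)
       (φ : CompleteLattice.Carrier L → CompleteLattice.Carrier M) →
       IsLatHom (raw L) (raw M) φ → (𝔛 : RelStr τ ι) →
       IsAlgHom (raw L ^ 𝔛) (raw M ^ 𝔛) (liftL (raw L) (raw M) φ 𝔛))
  -- ... p^L is a morphism of Alg_τ for every p-morphism p ...
  × (∀ (L : CompleteLattice c ℓ ι) (𝔛 𝔜 : RelStr τ ι) (p : X 𝔛 → X 𝔜) →
       IsPMorphism 𝔛 𝔜 p →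
       IsAlgHom (raw L ^ 𝔜) (raw L ^ 𝔛) (liftR (raw L) 𝔛 𝔜 p))
  -- ... and the assignment is functorial (covariant in L, contravariant in 𝔛)
  × (∀ (L : CompleteLattice c ℓ ι) (𝔛 : RelStr τ ι) (α : X 𝔛 → CompleteLattice.Carrier L) →
       RawAlg._≈_ (raw L ^ 𝔛) (liftL (raw L) (raw L) id 𝔛 α) α)
  × (∀ (L : CompleteLattice c ℓ ι) (M : CompleteLattice c' ℓ' ι) (N : CompleteLattice c'' ℓ'' ι)
       (φ : CompleteLattice.Carrier L → CompleteLattice.Carrier M)
       (ψ : CompleteLattice.Carrier M → CompleteLattice.Carrier N)
       (𝔛 : RelStr τ ι) (α : X 𝔛 → CompleteLattice.Carrier L) →
       RawAlg._≈_ (raw N ^ 𝔛) (liftL (raw L) (raw N) (ψ ∘ φ) 𝔛 α)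
         (liftL (raw M) (raw N) ψ 𝔛 (liftL (raw L) (raw M) φ 𝔛 α)))
  × (∀ (L : CompleteLattice c ℓ ι) (𝔛 : RelStr τ ι) (β : X 𝔛 → CompleteLattice.Carrier L) →
       RawAlg._≈_ (raw L ^ 𝔛) (liftR (raw L) 𝔛 𝔛 id β) β)
  × (∀ (L : CompleteLattice c ℓ ι) (𝔛 𝔜 ℨ : RelStr τ ι) (p : X 𝔛 → X 𝔜) (q : X 𝔜 → X ℨ)
       (γ : X ℨ → CompleteLattice.Carrier L) →
       RawAlg._≈_ (raw L ^ 𝔛) (liftR (raw L) 𝔛 ℨ (q ∘ p) γ)
         (liftR (raw L) 𝔛 𝔜 p (liftR (raw L) 𝔜 ℨ q γ)))
  × (∀ (L : CompleteLattice c ℓ ι) (M : CompleteLattice c' ℓ' ι)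
       (φ : CompleteLattice.Carrier L → CompleteLattice.Carrier M)
       (𝔛 𝔜 : RelStr τ ι) (p : X 𝔛 → X 𝔜) (β : X 𝔜 → CompleteLattice.Carrier L) →
       RawAlg._≈_ (raw M ^ 𝔛) (liftL (raw L) (raw M) φ 𝔛 (liftR (raw L) 𝔛 𝔜 p β))
         (liftR (raw M) 𝔛 𝔜 p (liftL (raw L) (raw M) φ 𝔜 β))) )
  -- (b) (∏_J L_j)^𝔛 ≅ ∏_J L_j^𝔛
  × (∀ (J : Set ι) (L : J → CompleteLattice c ℓ ι) (𝔛 : RelStr τ ι) →
       (∏CL J (λ j → raw (L j)) ^ 𝔛) ≅ ∏Alg J (λ j → raw (L j) ^ 𝔛))
  -- (c) L^(⊕_J 𝔛_j) ≅ ∏_J L^𝔛_j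
  × (∀ (L : CompleteLattice c ℓ ι) (J : Set ι) (𝔛 : J → RelStr τ ι) →
       (raw L ^ ⨁ J 𝔛) ≅ ∏Alg J (λ j → raw L ^ 𝔛 j))
  -- (d) φ one-one/onto ⇒ φ^𝔛 one-one/onto; converses when X is nonempty
  × (∀ (L : CompleteLattice c ℓ ι) (M : CompleteLattice c' ℓ' ι)
       (φ : CompleteLattice.Carrier L → CompleteLattice.Carrier M) →
       IsLatHom (raw L) (raw M) φ → (𝔛 : RelStr τ ι) →
       (OneOne (CompleteLattice._≈_ L) (CompleteLattice._≈_ M) φ →
          OneOne (RawAlg._≈_ (raw L ^ 𝔛)) (RawAlg._≈_ (raw M ^ 𝔛)) (liftL (raw L) (raw M) φ 𝔛))
       × (Onto (CompleteLattice._≈_ M) φ →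
          Onto (RawAlg._≈_ (raw M ^ 𝔛)) (liftL (raw L) (raw M) φ 𝔛))
       × (X 𝔛 →
            (OneOne (RawAlg._≈_ (raw L ^ 𝔛)) (RawAlg._≈_ (raw M ^ 𝔛)) (liftL (raw L) (raw M) φ 𝔛) →
               OneOne (CompleteLattice._≈_ L) (CompleteLattice._≈_ M) φ)
          × (Onto (RawAlg._≈_ (raw M ^ 𝔛)) (liftL (raw L) (raw M) φ 𝔛) →
               Onto (CompleteLattice._≈_ M) φ)))
  -- (e) p one-one ⇒ p^L onto;  p onto ⇒ p^L one-one
  × (∀ (L : CompleteLattice c ℓ ι) (𝔛 𝔜 : RelStr τ ι) (p : X 𝔛 → X 𝔜) →
       IsPMorphism 𝔛 𝔜 p →
       (OneOne _≡_ _≡_ p → Onto (RawAlg._≈_ (raw L ^ 𝔛)) (liftR (raw L) 𝔛 𝔜 p))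
       × (Onto _≡_ p → OneOne (RawAlg._≈_ (raw L ^ 𝔜)) (RawAlg._≈_ (raw L ^ 𝔛)) (liftR (raw L) 𝔛 𝔜 p)))
theorem3p15 τ =
  ( ( power-isCompleteLattice
    , liftL-isAlgHom
    , liftR-isAlgHom
    , (λ L _ _ _ → CL.Eq.refl L)
    , (λ _ _ N _ _ _ _ _ → CL.Eq.refl N)
    , (λ L _ _ _ → CL.Eq.refl L)
    , (λ L _ _ _ _ _ _ _ → CL.Eq.refl L)
    , (λ _ M _ _ _ _ _ _ → CL.Eq.refl M) )
  , power-of-product
  , power-of-coproduct
  , (λ L M φ _ 𝔛 →
         liftL-oneOne (raw L) (raw M) φ 𝔛
       , liftL-onto (raw L) (raw M) φ 𝔛
       , λ x₀ → oneOne-of-liftL (raw L) (raw M) φ 𝔛 x₀ , onto-of-liftL (raw L) (raw M) φ 𝔛 x₀)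
  , (λ L 𝔛 𝔜 p _ → liftR-onto L 𝔛 𝔜 p , liftR-oneOne L 𝔛 𝔜 p) )
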